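{- Let $m$ be a positive integer, $r$ a nonnegative integer, $\lambda\in\mathbb{R}$, and $0\le k\le n$. Then $$V_{m,m\lambda}^{(r)}(n,k)=\sum_{i=k}^{n}\binom{i}{k}m^{n-i}S_{1,\lambda}(n,i)(-r)_{i-k,m\lambda}.$$
   Context: $(x)_{0,\lambda}=1$, $(x)_{n,\lambda}=x(x-\lambda)\cdots(x-(n-1)\lambda)$, $(x)_n=(x)_{n,1}$. The degenerate Stirling numbers of the first kind are defined by $(x)_n=\sum_{k=0}^n S_{1,\lambda}(n,k)(x)_{k,\lambda}$. For a positive integer $m$, nonnegative integer $r$ and real $\mu$, the degenerate $r$-Whitney numbers of the first kind $V_{m,\mu}^{(r)}(n,k)$ are defined by $m^n(x)_n=\sum_{k=0}^n V_{m,\mu}^{(r)}(n,k)(mx+r)_{k,\mu}$ (polynomial identity in $x$). -}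

module Defs where

open import Level using (Level)
open import Data.Nat using (ℕ; zero; suc; _∸_)
open import Data.Nat.Combinatorics using (_C_)
open import Data.Empty using (⊥)
open import Relation.Binary.PropositionalEquality using (_≡_)
open import Algebra.Bundles using (CommutativeRing)

module Ring {c ℓ : Level} (R : CommutativeRing c ℓ) where
  open CommutativeRing R hiding (zero)

  ι : ℕ → Carrier
  ι zero    = 0#
  ι (suc n) = 1# + ι n

  pow : Carrier → ℕ → Carrier
  pow a zero    = 1#
  pow a (suc n) = pow a n * a

  fallingλ : Carrier → Carrier → ℕ → Carrier
  fallingλ x l zero    = 1#
  fallingλ x l (suc n) = fallingλ x l n * (x - ι n * l)

  falling : Carrier → ℕ → Carrier
  falling x n = fallingλ x 1# n

  sumTo : ℕ → (ℕ → Carrier) → Carrier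
  sumTo zero    f = f zero
  sumTo (suc n) f = sumTo n f + f (suc n)

  -- Σ_{i=k}^{n} f i   (intended for k ≤ n)
  sumFromTo : ℕ → ℕ → (ℕ → Carrier) → Carrier
  sumFromTo k n f = sumTo (n ∸ k) (λ j → f (k Data.Nat.+ j))

  binom : ℕ → ℕ → Carrier
  binom i k = ι (i C k)

  CharZero : Set ℓ
  CharZero = ∀ n → ι (suc n) ≈ 0# → ⊥

  NoZeroDivisors : Set (c Level.⊔ ℓ)
  NoZeroDivisors = ∀ a b → a * b ≈ 0# → (a ≈ 0#) Data.Sum.⊎ (b ≈ 0#)
    where import Data.Sum

  -- S is a family of degenerate Stirling numbers of the first kind S_{1,λ}(n,k):
  --   (x)_n = Σ_{k=0}^{n} S(n,k) (x)_{k,λ}   for all x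
  IsDegStirling1 : Carrier → (ℕ → ℕ → Carrier) → Set (c Level.⊔ ℓ)
  IsDegStirling1 l S = ∀ n x → falling x n ≈ sumTo n (λ k → S n k * fallingλ x l k)

  -- V is a family of degenerate r-Whitney numbers of the first kind V^{(r)}_{m,μ}(n,k):
  --   m^n (x)_n = Σ_{k=0}^{n} V(n,k) (m x + r)_{k,μ}   for all x
  IsDegWhitney1 : ℕ → ℕ → Carrier → (ℕ → ℕ → Carrier) → Set (c Level.⊔ ℓ)
  IsDegWhitney1 m r μ V =
    ∀ n x → pow (ι m) n * falling x n
          ≈ sumTo n (λ k → V n k * fallingλ (ι m * x + ι r) μ k)

-- Expanding (x)_n in degenerate falling factorials and multiplying by m^n gives
-- m^n (x)_n = Σ_i m^(n-i) S_{1,λ}(n,i) (mx)_{i,mλ}.  Writing mx = (mx + r) + (-r), the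
-- degenerate binomial theorem (a + b)_{i,μ} = Σ_k C(i,k) (a)_{k,μ} (b)_{i-k,μ} expands this
-- in the functions (mx + r)_{k,mλ}, and exchanging the two sums exhibits the claimed numbers
-- as coefficients of m^n (x)_n in that family.  The family is a basis: (mx + r)_{k,mλ} is a
-- polynomial in x of degree k with leading coefficient m^k, which is nonzero in a domain of
-- characteristic zero, so comparing k-th finite differences identifies the coefficients.

module Submission where

open import Defs
open import Level using (Level; _⊔_)
open import Algebra.Bundles using (CommutativeRing; RawRing)
import Algebra.Solver.Ring as RingSolver
open import Algebra.Solver.Ring.AlmostCommutativeRing
  using (_-Raw-AlmostCommutative⟶_; fromCommutativeRing)
open import Data.Empty using (⊥-elim)
open import Data.Maybe using (Maybe; nothing; just)
open import Data.Nat using (ℕ; zero; suc; _≤_; _<_; _∸_; NonZero; z≤n; s≤s; _≤′_; ≤′-reflexive; ≤′-step)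
import Data.Nat as ℕ
open import Data.Nat.Combinatorics using (_C_; nCk+nC[k+1]≡[n+1]C[k+1]; k>n⇒nCk≡0)
import Data.Nat.Properties as ℕ
open import Data.Product using (_×_; _,_)
open import Data.Sum using (inj₁; inj₂)
open import Function using (_∘_)
open import Relation.Binary.PropositionalEquality as ≡ using (_≡_)
open import Relation.Nullary using (¬_; yes; no)

module Theory {c ℓ : Level} (R : CommutativeRing c ℓ) where
  open CommutativeRing R hiding (zero)
  open Ring R
  open import Algebra.Properties.Ring ring
    using (-‿+-comm; -‿distribˡ-*; -‿distribʳ-*; -‿involutive; -0#≈0#;
           ⁻¹-anti-homo‿-; x∙y⁻¹≈ε⇒x≈y; x≈y⇒x∙y⁻¹≈ε; +-cancelʳ; x[y-z]≈xy-xz; [y-z]x≈yx-zx)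
  open import Relation.Binary.Reasoning.Setoid setoid

  ι-+ : ∀ a b → ι (a ℕ.+ b) ≈ ι a + ι b
  ι-+ zero    b = sym (+-identityˡ _)
  ι-+ (suc a) b = trans (+-congˡ (ι-+ a b)) (sym (+-assoc _ _ _))

  ι-* : ∀ a b → ι (a ℕ.* b) ≈ ι a * ι b
  ι-* zero    b = sym (zeroˡ _)
  ι-* (suc a) b = begin
    ι (b ℕ.+ a ℕ.* b)        ≈⟨ trans (ι-+ b (a ℕ.* b)) (+-congˡ (ι-* a b)) ⟩
    ι b + ι a * ι b          ≈⟨ +-congʳ (*-identityˡ _) ⟨
    1# * ι b + ι a * ι b     ≈⟨ distribʳ _ _ _ ⟨
    (1# + ι a) * ι b         ∎

  ι-1 : ι 1 ≈ 1#
  ι-1 = +-identityʳ 1#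

  -- Integer coefficients for the ring solver: a pair (a , b) stands for ι a - ι b.  The
  -- solver only needs a homomorphism out of the raw operations, so no laws are proved for them.
  ℕ² : RawRing _ _
  ℕ² = record
    { Carrier = ℕ × ℕ
    ; _≈_     = _≡_
    ; _+_     = λ { (a , b) (c , d) → a ℕ.+ c , b ℕ.+ d }
    ; _*_     = λ { (a , b) (c , d) → a ℕ.* c ℕ.+ b ℕ.* d , a ℕ.* d ℕ.+ b ℕ.* c }
    ; -_      = λ { (a , b) → b , a }
    ; 0#      = 0 , 0
    ; 1#      = 1 , 0
    }

  ⟦_⟧ℕ² : ℕ × ℕ → Carrier
  ⟦ a , b ⟧ℕ² = ι a - ι b

  private
    -*- : ∀ x y → - x * - y ≈ x * y
    -*- x y = begin
      - x * - y        ≈⟨ -‿distribˡ-* x (- y) ⟨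
      - (x * - y)      ≈⟨ -‿cong (-‿distribʳ-* x y) ⟨
      - - (x * y)      ≈⟨ -‿involutive _ ⟩
      x * y            ∎

    +-exchange : ∀ w x y z → (w + x) + (y + z) ≈ (w + y) + (x + z)
    +-exchange w x y z = begin
      (w + x) + (y + z)   ≈⟨ +-assoc w x (y + z) ⟩
      w + (x + (y + z))   ≈⟨ +-congˡ (+-assoc x y z) ⟨
      w + ((x + y) + z)   ≈⟨ +-congˡ (+-congʳ (+-comm x y)) ⟩
      w + ((y + x) + z)   ≈⟨ +-congˡ (+-assoc y x z) ⟩
      w + (y + (x + z))   ≈⟨ +-assoc w y (x + z) ⟨
      (w + y) + (x + z)   ∎

    ι-+₂ : ∀ a b c d → ι (a ℕ.+ b) - ι (c ℕ.+ d) ≈ (ι a + ι b) + (- ι c + - ι d)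
    ι-+₂ a b c d = +-cong (ι-+ a b) (trans (-‿cong (ι-+ c d)) (sym (-‿+-comm _ _)))

  ⟦⟧ℕ²-homo : ℕ² -Raw-AlmostCommutative⟶ fromCommutativeRing R
  ⟦⟧ℕ²-homo = record
    { ⟦_⟧    = ⟦_⟧ℕ²
    ; +-homo = λ { (a , b) (c , d) → trans (ι-+₂ a c b d) (+-exchange _ _ _ _) }
    ; *-homo = λ { (a , b) (c , d) → begin
        ι (a ℕ.* c ℕ.+ b ℕ.* d) - ι (a ℕ.* d ℕ.+ b ℕ.* c)
          ≈⟨ trans (ι-+₂ (a ℕ.* c) (b ℕ.* d) (a ℕ.* d) (b ℕ.* c))
                   (+-cong (+-cong (ι-* a c) (ι-* b d)) (+-cong (-‿cong (ι-* a d)) (-‿cong (ι-* b c)))) ⟩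
        (ι a * ι c + ι b * ι d) + (- (ι a * ι d) + - (ι b * ι c))
          ≈⟨ +-cong (+-congˡ (sym (-*- _ _))) (+-cong (-‿distribʳ-* _ _) (-‿distribˡ-* _ _)) ⟩
        (ι a * ι c + - ι b * - ι d) + (ι a * - ι d + - ι b * ι c)
          ≈⟨ +-exchange _ _ _ _ ⟩
        (ι a * ι c + ι a * - ι d) + (- ι b * - ι d + - ι b * ι c)
          ≈⟨ +-cong (distribˡ _ _ _) (trans (distribˡ _ _ _) (+-comm _ _)) ⟨
        ι a * (ι c - ι d) + - ι b * (ι c - ι d)
          ≈⟨ distribʳ _ _ _ ⟨
        (ι a - ι b) * (ι c - ι d) ∎ }
    ; -‿homo = λ { (a , b) → sym (⁻¹-anti-homo‿- (ι a) (ι b)) }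
    ; 0-homo = -‿inverseʳ 0#
    ; 1-homo = trans (+-cong ι-1 -0#≈0#) (+-identityʳ 1#)
    }

  ⟦⟧ℕ²-≟ : ∀ p q → Maybe (⟦ p ⟧ℕ² ≈ ⟦ q ⟧ℕ²)
  ⟦⟧ℕ²-≟ (a , b) (c , d) with a ℕ.+ d ℕ.≟ c ℕ.+ b
  ... | no  _ = nothing
  ... | yes e = just (x∙y⁻¹≈ε⇒x≈y _ _ (begin
    (ι a - ι b) - (ι c - ι d)      ≈⟨ +-congˡ (⁻¹-anti-homo‿- (ι c) (ι d)) ⟩
    (ι a - ι b) + (ι d - ι c)      ≈⟨ +-exchange _ _ _ _ ⟩
    (ι a + ι d) + (- ι b + - ι c)  ≈⟨ +-congˡ (trans (+-comm _ _) (-‿+-comm _ _)) ⟩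
    (ι a + ι d) - (ι c + ι b)      ≈⟨ +-cong (ι-+ a d) (-‿cong (ι-+ c b)) ⟨
    ι (a ℕ.+ d) - ι (c ℕ.+ b)      ≈⟨ x≈y⇒x∙y⁻¹≈ε (reflexive (≡.cong ι e)) ⟩
    0#                             ∎))

  open RingSolver ℕ² (fromCommutativeRing R) ⟦⟧ℕ²-homo ⟦⟧ℕ²-≟
    using (solve; _:+_; _:*_; _:-_; :-_; _:=_)

  sumTo-cong-≤ : ∀ n {f g : ℕ → Carrier} → (∀ k → k ≤ n → f k ≈ g k) → sumTo n f ≈ sumTo n g
  sumTo-cong-≤ zero    f≈g = f≈g 0 z≤n
  sumTo-cong-≤ (suc n) f≈g =
    +-cong (sumTo-cong-≤ n (λ k k≤n → f≈g k (ℕ.m≤n⇒m≤1+n k≤n))) (f≈g (suc n) ℕ.≤-refl)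

  sumTo-cong : ∀ n {f g : ℕ → Carrier} → (∀ k → f k ≈ g k) → sumTo n f ≈ sumTo n g
  sumTo-cong n f≈g = sumTo-cong-≤ n (λ k _ → f≈g k)

  sumTo-+ : ∀ n (f g : ℕ → Carrier) → sumTo n (λ k → f k + g k) ≈ sumTo n f + sumTo n g
  sumTo-+ zero    f g = refl
  sumTo-+ (suc n) f g = trans (+-congʳ (sumTo-+ n f g)) (+-exchange _ _ _ _)

  sumTo-*ˡ : ∀ n a (f : ℕ → Carrier) → a * sumTo n f ≈ sumTo n (λ k → a * f k)
  sumTo-*ˡ zero    a f = refl
  sumTo-*ˡ (suc n) a f = trans (distribˡ _ _ _) (+-congʳ (sumTo-*ˡ n a f))

  sumTo-*ʳ : ∀ n a (f : ℕ → Carrier) → sumTo n f * a ≈ sumTo n (λ k → f k * a)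
  sumTo-*ʳ zero    a f = refl
  sumTo-*ʳ (suc n) a f = trans (distribʳ _ _ _) (+-congʳ (sumTo-*ʳ n a f))

  sumTo-suc : ∀ n (f : ℕ → Carrier) → sumTo (suc n) f ≈ f 0 + sumTo n (f ∘ suc)
  sumTo-suc zero    f = refl
  sumTo-suc (suc n) f = trans (+-congʳ (sumTo-suc n f)) (+-assoc _ _ _)

  sumTo-comm : ∀ n n′ (g : ℕ → ℕ → Carrier) →
    sumTo n (λ i → sumTo n′ (g i)) ≈ sumTo n′ (λ k → sumTo n (λ i → g i k))
  sumTo-comm zero    n′ g = refl
  sumTo-comm (suc n) n′ g = trans (+-congʳ (sumTo-comm n n′ g)) (sym (sumTo-+ n′ _ _))

  sumTo-extend : ∀ {i n} (f : ℕ → Carrier) → i ≤ n → (∀ k → i < k → f k ≈ 0#) →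
    sumTo i f ≈ sumTo n f
  sumTo-extend {i} f i≤n f≈0 = go (ℕ.≤⇒≤′ i≤n)
    where
    go : ∀ {n} → i ≤′ n → sumTo i f ≈ sumTo n f
    go (≤′-reflexive ≡.refl) = refl
    go (≤′-step {n} i≤′n)    = begin
      sumTo i f                ≈⟨ go i≤′n ⟩
      sumTo n f                ≈⟨ +-identityʳ _ ⟨
      sumTo n f + 0#           ≈⟨ +-congˡ (f≈0 (suc n) (s≤s (ℕ.≤′⇒≤ i≤′n))) ⟨
      sumTo n f + f (suc n)    ∎

  sumTo-dropLow : ∀ {n} k (f : ℕ → Carrier) → k ≤ n → (∀ i → i < k → f i ≈ 0#) →
    sumTo n f ≈ sumFromTo k n f
  sumTo-dropLow           zero    f k≤n       f≈0 = refl
  sumTo-dropLow {suc n}   (suc k) f (s≤s k≤n) f≈0 = begin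
    sumTo (suc n) f               ≈⟨ sumTo-suc n f ⟩
    f 0 + sumTo n (f ∘ suc)       ≈⟨ +-congʳ (f≈0 0 (s≤s z≤n)) ⟩
    0# + sumTo n (f ∘ suc)        ≈⟨ +-identityˡ _ ⟩
    sumTo n (f ∘ suc)             ≈⟨ sumTo-dropLow k (f ∘ suc) k≤n (λ i i<k → f≈0 (suc i) (s≤s i<k)) ⟩
    sumFromTo k n (f ∘ suc)       ∎

  binom-n0 : ∀ n → binom n 0 ≈ 1#
  binom-n0 n = ι-1

  binom-> : ∀ {i k} → i < k → binom i k ≈ 0#
  binom-> i<k = reflexive (≡.cong ι (k>n⇒nCk≡0 i<k))

  binom-suc : ∀ i k → binom (suc i) (suc k) ≈ binom i k + binom i (suc k)
  binom-suc i k =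
    trans (reflexive (≡.cong ι (≡.sym (nCk+nC[k+1]≡[n+1]C[k+1] i k)))) (ι-+ (i C k) (i C suc k))

  pascal-sumTo : ∀ i (f : ℕ → Carrier) →
    sumTo (suc i) (λ k → binom (suc i) k * f k)
      ≈ sumTo i (λ k → binom i k * f k) + sumTo i (λ k → binom i k * f (suc k))
  pascal-sumTo i f = begin
    sumTo (suc i) (λ k → binom (suc i) k * f k)
      ≈⟨ sumTo-suc i _ ⟩
    binom (suc i) 0 * f 0 + sumTo i (λ k → binom (suc i) (suc k) * f (suc k))
      ≈⟨ +-congˡ (sumTo-cong i (λ k → trans (*-congʳ (binom-suc i k)) (distribʳ _ _ _))) ⟩
    binom i 0 * f 0 + sumTo i (λ k → binom i k * f (suc k) + binom i (suc k) * f (suc k))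
      ≈⟨ +-congˡ (trans (sumTo-+ i _ _) (+-comm _ _)) ⟩
    binom i 0 * f 0 + (sumTo i (λ k → binom i (suc k) * f (suc k)) + sumTo i (λ k → binom i k * f (suc k)))
      ≈⟨ +-assoc _ _ _ ⟨
    (binom i 0 * f 0 + sumTo i (λ k → binom i (suc k) * f (suc k))) + sumTo i (λ k → binom i k * f (suc k))
      ≈⟨ +-congʳ (sumTo-suc i _) ⟨
    (sumTo i (λ k → binom i k * f k) + binom i (suc i) * f (suc i)) + sumTo i (λ k → binom i k * f (suc k))
      ≈⟨ +-congʳ (trans (+-congˡ (trans (*-congʳ (binom-> (ℕ.n<1+n i))) (zeroˡ _))) (+-identityʳ _)) ⟩
    sumTo i (λ k → binom i k * f k) + sumTo i (λ k → binom i k * f (suc k)) ∎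

  fallingλ-cong : ∀ {x y} u i → x ≈ y → fallingλ x u i ≈ fallingλ y u i
  fallingλ-cong u zero    x≈y = refl
  fallingλ-cong u (suc i) x≈y = *-cong (fallingλ-cong u i x≈y) (+-congʳ x≈y)

  fallingλ-+ : ∀ a b u i →
    fallingλ (a + b) u i ≈ sumTo i (λ k → binom i k * (fallingλ a u k * fallingλ b u (i ∸ k)))
  fallingλ-+ a b u zero    = sym (trans (*-congʳ (binom-n0 0)) (trans (*-identityˡ _) (*-identityˡ _)))
  fallingλ-+ a b u (suc i) = begin
    fallingλ (a + b) u i * ((a + b) - ι i * u)
      ≈⟨ trans (*-congʳ (fallingλ-+ a b u i)) (sumTo-*ʳ i _ _) ⟩
    sumTo i (λ k → binom i k * (A k * B (i ∸ k)) * ((a + b) - ι i * u))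
      ≈⟨ sumTo-cong-≤ i (λ k k≤i → trans (*-assoc _ _ _) (*-congˡ (step-≤ k≤i))) ⟩
    sumTo i (λ k → binom i k * (A (suc k) * B (i ∸ k) + A k * B (suc (i ∸ k))))
      ≈⟨ trans (sumTo-cong i (λ k → distribˡ _ _ _)) (trans (sumTo-+ i _ _) (+-comm _ _)) ⟩
    sumTo i (λ k → binom i k * (A k * B (suc (i ∸ k)))) + sumTo i (λ k → binom i k * (A (suc k) * B (i ∸ k)))
      ≈⟨ +-congʳ (sumTo-cong-≤ i (λ k k≤i → *-congˡ (*-congˡ (reflexive (≡.cong B (ℕ.+-∸-assoc 1 k≤i)))))) ⟨
    sumTo i (λ k → binom i k * (A k * B (suc i ∸ k))) + sumTo i (λ k → binom i k * (A (suc k) * B (i ∸ k)))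
      ≈⟨ pascal-sumTo i (λ k → A k * B (suc i ∸ k)) ⟨
    sumTo (suc i) (λ k → binom (suc i) k * (A k * B (suc i ∸ k))) ∎
    where
    A B : ℕ → Carrier
    A = fallingλ a u
    B = fallingλ b u
    step : ∀ k j → A k * B j * ((a + b) - ι (k ℕ.+ j) * u) ≈ A (suc k) * B j + A k * B (suc j)
    step k j = trans (*-congˡ (+-congˡ (-‿cong (*-congʳ (ι-+ k j)))))
      (solve 7 (λ Ak Bj a b K J u →
                  Ak :* Bj :* ((a :+ b) :- (K :+ J) :* u)
                  := Ak :* (a :- K :* u) :* Bj :+ Ak :* (Bj :* (b :- J :* u)))
             refl (A k) (B j) a b (ι k) (ι j) u)
    step-≤ : ∀ {k} → k ≤ i →
      A k * B (i ∸ k) * ((a + b) - ι i * u) ≈ A (suc k) * B (i ∸ k) + A k * B (suc (i ∸ k))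
    step-≤ {k} k≤i = trans (*-congˡ (+-congˡ (-‿cong (*-congʳ (ι-i≈ι-k+[i∸k]))))) (step k (i ∸ k))
      where ι-i≈ι-k+[i∸k] = reflexive (≡.cong ι (≡.sym (ℕ.m+[n∸m]≡n k≤i)))

  pow-+ : ∀ a i j → pow a (i ℕ.+ j) ≈ pow a i * pow a j
  pow-+ a zero    j = sym (*-identityˡ _)
  pow-+ a (suc i) j = begin
    pow a (i ℕ.+ j) * a          ≈⟨ *-congʳ (pow-+ a i j) ⟩
    pow a i * pow a j * a        ≈⟨ *-assoc _ _ _ ⟩
    pow a i * (pow a j * a)      ≈⟨ *-congˡ (*-comm _ _) ⟩
    pow a i * (a * pow a j)      ≈⟨ *-assoc _ _ _ ⟨
    pow a i * a * pow a j        ∎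

  pow-∸ : ∀ a {n i} → i ≤ n → pow a n ≈ pow a (n ∸ i) * pow a i
  pow-∸ a {n} {i} i≤n =
    trans (reflexive (≡.cong (pow a) (≡.sym (ℕ.m∸n+n≡m i≤n)))) (pow-+ a (n ∸ i) i)

  pow-*-fallingλ : ∀ a x u i → pow a i * fallingλ x u i ≈ fallingλ (a * x) (a * u) i
  pow-*-fallingλ a x u zero    = *-identityˡ _
  pow-*-fallingλ a x u (suc i) = trans
    (solve 6 (λ P F a x I u → (P :* a) :* (F :* (x :- I :* u)) := (P :* F) :* (a :* x :- I :* (a :* u)))
       refl (pow a i) (fallingλ x u i) a x (ι i) u)
    (*-congʳ (pow-*-fallingλ a x u i))

  Δ : (Carrier → Carrier) → Carrier → Carrier
  Δ f x = f (x + 1#) - f x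

  -- Polynomial d a f: f is a polynomial function of degree at most d whose coefficient of
  -- x^d is a; this is expressed without coefficients, as Δ^d f being the constant d! a.
  Polynomial : ℕ → Carrier → (Carrier → Carrier) → Set (c ⊔ ℓ)
  Polynomial zero    a f = ∀ x → f x ≈ a
  Polynomial (suc d) a f = Polynomial d (ι (suc d) * a) (Δ f)

  Polynomial-resp-≗ : ∀ d {a} {f g : Carrier → Carrier} →
    (∀ x → f x ≈ g x) → Polynomial d a f → Polynomial d a g
  Polynomial-resp-≗ zero    f≈g pf x = trans (sym (f≈g x)) (pf x)
  Polynomial-resp-≗ (suc d) f≈g pf = Polynomial-resp-≗ d (λ x → +-cong (f≈g _) (-‿cong (f≈g x))) pf

  Polynomial-resp-≈ : ∀ d {a b} {f : Carrier → Carrier} → a ≈ b → Polynomial d a f → Polynomial d b f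
  Polynomial-resp-≈ zero    a≈b pf x = trans (pf x) a≈b
  Polynomial-resp-≈ (suc d) a≈b pf = Polynomial-resp-≈ d (*-congˡ a≈b) pf

  Polynomial-+ : ∀ d {a b} {f g : Carrier → Carrier} →
    Polynomial d a f → Polynomial d b g → Polynomial d (a + b) (λ x → f x + g x)
  Polynomial-+ zero    pf pg x = +-cong (pf x) (pg x)
  Polynomial-+ (suc d) {f = f} {g} pf pg =
    Polynomial-resp-≈ d (sym (distribˡ _ _ _))
      (Polynomial-resp-≗ d Δ-+ (Polynomial-+ d pf pg))
    where
    Δ-+ : ∀ x → Δ f x + Δ g x ≈ Δ (λ y → f y + g y) x
    Δ-+ x = solve 4 (λ f₁ g₁ f₀ g₀ → (f₁ :- f₀) :+ (g₁ :- g₀) := (f₁ :+ g₁) :- (f₀ :+ g₀))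
              refl (f (x + 1#)) (g (x + 1#)) (f x) (g x)

  Polynomial-*ˡ : ∀ d s {a} {f : Carrier → Carrier} →
    Polynomial d a f → Polynomial d (s * a) (λ x → s * f x)
  Polynomial-*ˡ zero    s pf x = *-congˡ (pf x)
  Polynomial-*ˡ (suc d) s {a} pf =
    Polynomial-resp-≈ d (solve 3 (λ s K a → s :* (K :* a) := K :* (s :* a)) refl s (ι (suc d)) a)
      (Polynomial-resp-≗ d (λ x → x[y-z]≈xy-xz s _ _) (Polynomial-*ˡ d s pf))

  Polynomial-suc : ∀ d {a} {f : Carrier → Carrier} → Polynomial d a f → Polynomial (suc d) 0# f
  Polynomial-suc zero {a} {f} pf x = begin
    Δ f x        ≈⟨ +-cong (pf _) (-‿cong (pf x)) ⟩
    a - a        ≈⟨ -‿inverseʳ a ⟩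
    0#           ≈⟨ zeroʳ _ ⟨
    ι 1 * 0#     ∎
  Polynomial-suc (suc d) pf = Polynomial-resp-≈ (suc d) (sym (zeroʳ _)) (Polynomial-suc d pf)

  -- Δ (f L) x = Δ f x · L (x + 1) + s · f x  for the linear function L x = s x + t.
  Polynomial-*-linear : ∀ d {a} {f : Carrier → Carrier} → Polynomial d a f → ∀ s t →
    Polynomial (suc d) (a * s) (λ x → f x * (s * x + t))
  Polynomial-*-linear zero {a} {f} pf s t x = begin
    f (x + 1#) * (s * (x + 1#) + t) - f x * (s * x + t)
      ≈⟨ +-cong (*-congʳ (pf _)) (-‿cong (*-congʳ (pf x))) ⟩
    a * (s * (x + 1#) + t) - a * (s * x + t)
      ≈⟨ solve 5 (λ a s x t o → a :* (s :* (x :+ o) :+ t) :- a :* (s :* x :+ t) := o :* (a :* s))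
           refl a s x t 1# ⟩
    1# * (a * s)
      ≈⟨ *-congʳ ι-1 ⟨
    ι 1 * (a * s) ∎
  Polynomial-*-linear (suc d) {a} {f} pf s t =
    Polynomial-resp-≈ (suc d)
      (solve 4 (λ K a s o → (K :* a) :* s :+ (s :* o) :* a := (o :+ K) :* (a :* s))
         refl (ι (suc d)) a s 1#)
      (Polynomial-resp-≗ (suc d) product-rule
        (Polynomial-+ (suc d) (Polynomial-*-linear d pf s (s * 1# + t))
                              (Polynomial-*ˡ (suc d) (s * 1#) {f = f} pf)))
    where
    product-rule : ∀ x → Δ f x * (s * x + (s * 1# + t)) + s * 1# * f x ≈ Δ (λ y → f y * (s * y + t)) x
    product-rule x = solve 6 (λ f₁ f₀ s x t o →
        (f₁ :- f₀) :* (s :* x :+ (s :* o :+ t)) :+ s :* o :* f₀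
        := f₁ :* (s :* (x :+ o) :+ t) :- f₀ :* (s :* x :+ t))
      refl (f (x + 1#)) (f x) s x t 1#

  fallingλ-Polynomial : ∀ s t u k → Polynomial k (pow s k) (λ x → fallingλ (s * x + t) u k)
  fallingλ-Polynomial s t u zero    x = refl
  fallingλ-Polynomial s t u (suc k) =
    Polynomial-resp-≗ (suc k) (λ x → *-congˡ (sym (+-assoc _ _ _)))
      (Polynomial-*-linear k (fallingλ-Polynomial s t u k) s (t - ι k * u))

  sumTo-Polynomial : ∀ {lc : ℕ → Carrier} {p : ℕ → Carrier → Carrier} →
    (∀ k → Polynomial k (lc k) (p k)) →
    ∀ n (a : ℕ → Carrier) → Polynomial n (a n * lc n) (λ x → sumTo n (λ k → a k * p k x))
  sumTo-Polynomial pp zero    a = Polynomial-*ˡ 0 (a 0) (pp 0)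
  sumTo-Polynomial pp (suc n) a = Polynomial-resp-≈ (suc n) (+-identityˡ _)
    (Polynomial-+ (suc n) (Polynomial-suc n (sumTo-Polynomial pp n a))
                          (Polynomial-*ˡ (suc n) (a (suc n)) (pp (suc n))))

  module Domain (charZero : CharZero) (noZeroDivisors : NoZeroDivisors) where

    *-cancelʳ-nonZero : ∀ {a b c} → ¬ c ≈ 0# → a * c ≈ b * c → a ≈ b
    *-cancelʳ-nonZero {a} {b} {c} c≉0 ac≈bc
      with noZeroDivisors (a - b) c (trans ([y-z]x≈yx-zx c a b) (x≈y⇒x∙y⁻¹≈ε ac≈bc))
    ... | inj₁ a-b≈0 = x∙y⁻¹≈ε⇒x≈y a b a-b≈0
    ... | inj₂ c≈0   = ⊥-elim (c≉0 c≈0)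

    ι-nonZero : ∀ m → .{{NonZero m}} → ¬ ι m ≈ 0#
    ι-nonZero (suc m) = charZero m

    pow-nonZero : ∀ {a} → ¬ a ≈ 0# → ∀ k → ¬ pow a k ≈ 0#
    pow-nonZero a≉0 zero    1≈0 = charZero 0 (trans ι-1 1≈0)
    pow-nonZero a≉0 (suc k) aᵏ⁺¹≈0 with noZeroDivisors _ _ aᵏ⁺¹≈0
    ... | inj₁ aᵏ≈0 = pow-nonZero a≉0 k aᵏ≈0
    ... | inj₂ a≈0  = a≉0 a≈0

    Polynomial-leading-unique : ∀ d {a b} {f g : Carrier → Carrier} →
      Polynomial d a f → Polynomial d b g → (∀ x → f x ≈ g x) → a ≈ b
    Polynomial-leading-unique zero    pf pg f≈g = trans (sym (pf 0#)) (trans (f≈g 0#) (pg 0#))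
    Polynomial-leading-unique (suc d) pf pg f≈g =
      *-cancelʳ-nonZero (charZero d)
        (trans (*-comm _ _) (trans (Polynomial-leading-unique d pf pg Δf≈Δg) (*-comm _ _)))
      where Δf≈Δg = λ x → +-cong (f≈g _) (-‿cong (f≈g x))

    module _ {lc : ℕ → Carrier} {p : ℕ → Carrier → Carrier}
             (p-Polynomial : ∀ k → Polynomial k (lc k) (p k)) (lc≉0 : ∀ k → ¬ lc k ≈ 0#) where

      leading-coefficient-unique : ∀ n {a b : ℕ → Carrier} →
        (∀ x → sumTo n (λ k → a k * p k x) ≈ sumTo n (λ k → b k * p k x)) → a n ≈ b n
      leading-coefficient-unique n {a} {b} Σap≈Σbp = *-cancelʳ-nonZero (lc≉0 n)
        (Polynomial-leading-unique n (sumTo-Polynomial p-Polynomial n a) (sumTo-Polynomial p-Polynomial n b)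
          Σap≈Σbp)

      coefficients-unique : ∀ n {a b : ℕ → Carrier} →
        (∀ x → sumTo n (λ k → a k * p k x) ≈ sumTo n (λ k → b k * p k x)) →
        ∀ j → j ≤ n → a j ≈ b j
      coefficients-unique zero {a} {b} Σap≈Σbp zero z≤n = leading-coefficient-unique zero {a} {b} Σap≈Σbp
      coefficients-unique (suc n) {a} {b} Σap≈Σbp j j≤n with ℕ.m≤n⇒m<n∨m≡n j≤n
      ... | inj₂ ≡.refl    = leading-coefficient-unique (suc n) Σap≈Σbp
      ... | inj₁ (s≤s j≤n) = coefficients-unique n Σ′ap≈Σ′bp j j≤n
        where
        Σ′ap≈Σ′bp : ∀ x → sumTo n (λ k → a k * p k x) ≈ sumTo n (λ k → b k * p k x)
        Σ′ap≈Σ′bp x = +-cancelʳ _ _ _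
          (trans (Σap≈Σbp x) (+-congˡ (*-congʳ (sym (leading-coefficient-unique (suc n) Σap≈Σbp)))))

  module Whitney (m r : ℕ) (l : Carrier) (S : ℕ → ℕ → Carrier) (stirling : IsDegStirling1 l S) where

    μ : Carrier
    μ = ι m * l

    basis : ℕ → Carrier → Carrier
    basis k x = fallingλ (ι m * x + ι r) μ k

    stirlingSum : ℕ → ℕ → Carrier
    stirlingSum n k =
      sumFromTo k n (λ i → binom i k * pow (ι m) (n ∸ i) * S n i * fallingλ (- ι r) μ (i ∸ k))

    pow-*-falling : ∀ n x →
      pow (ι m) n * falling x n ≈ sumTo n (λ i → pow (ι m) (n ∸ i) * S n i * fallingλ (ι m * x) μ i)
    pow-*-falling n x = begin
      pow (ι m) n * falling x n
        ≈⟨ trans (*-congˡ (stirling n x)) (sumTo-*ˡ n _ _) ⟩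
      sumTo n (λ i → pow (ι m) n * (S n i * fallingλ x l i))
        ≈⟨ sumTo-cong-≤ n (λ i i≤n → trans (*-congʳ (pow-∸ (ι m) i≤n)) (regroup _ _ _ _)) ⟩
      sumTo n (λ i → pow (ι m) (n ∸ i) * S n i * (pow (ι m) i * fallingλ x l i))
        ≈⟨ sumTo-cong n (λ i → *-congˡ (pow-*-fallingλ (ι m) x l i)) ⟩
      sumTo n (λ i → pow (ι m) (n ∸ i) * S n i * fallingλ (ι m * x) μ i) ∎
      where
      regroup : ∀ p q s f → p * q * (s * f) ≈ p * s * (q * f)
      regroup = solve 4 (λ p q s f → p :* q :* (s :* f) := p :* s :* (q :* f)) refl

    fallingλ-basis : ∀ {n} x i → i ≤ n →
      fallingλ (ι m * x) μ i ≈ sumTo n (λ k → binom i k * (basis k x * fallingλ (- ι r) μ (i ∸ k)))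
    fallingλ-basis {n} x i i≤n = begin
      fallingλ (ι m * x) μ i
        ≈⟨ fallingλ-cong μ i (solve 2 (λ y r → y := (y :+ r) :+ (:- r)) refl (ι m * x) (ι r)) ⟩
      fallingλ ((ι m * x + ι r) + - ι r) μ i
        ≈⟨ fallingλ-+ (ι m * x + ι r) (- ι r) μ i ⟩
      sumTo i (λ k → binom i k * (basis k x * fallingλ (- ι r) μ (i ∸ k)))
        ≈⟨ sumTo-extend _ i≤n (λ k i<k → trans (*-congʳ (binom-> i<k)) (zeroˡ _)) ⟩
      sumTo n (λ k → binom i k * (basis k x * fallingλ (- ι r) μ (i ∸ k))) ∎

    expansion : ∀ n x → pow (ι m) n * falling x n ≈ sumTo n (λ k → stirlingSum n k * basis k x)
    expansion n x = begin
      pow (ι m) n * falling x n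
        ≈⟨ pow-*-falling n x ⟩
      sumTo n (λ i → w i * fallingλ (ι m * x) μ i)
        ≈⟨ sumTo-cong-≤ n (λ i i≤n → trans (*-congˡ (fallingλ-basis x i i≤n)) (sumTo-*ˡ n _ _)) ⟩
      sumTo n (λ i → sumTo n (λ k → w i * (binom i k * (basis k x * Q (i ∸ k)))))
        ≈⟨ sumTo-comm n n _ ⟩
      sumTo n (λ k → sumTo n (λ i → w i * (binom i k * (basis k x * Q (i ∸ k)))))
        ≈⟨ sumTo-cong n (λ k → trans (sumTo-cong n (λ i → regroup _ _ _ _ _)) (sym (sumTo-*ʳ n _ _))) ⟩
      sumTo n (λ k → sumTo n (term k) * basis k x)
        ≈⟨ sumTo-cong-≤ n (λ k k≤n → *-congʳ (sumTo-dropLow k (term k) k≤n (term-< k))) ⟩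
      sumTo n (λ k → stirlingSum n k * basis k x) ∎
      where
      w : ℕ → Carrier
      w i = pow (ι m) (n ∸ i) * S n i
      Q : ℕ → Carrier
      Q = fallingλ (- ι r) μ
      term : ℕ → ℕ → Carrier
      term k i = binom i k * pow (ι m) (n ∸ i) * S n i * Q (i ∸ k)
      regroup : ∀ p s b f q → p * s * (b * (f * q)) ≈ b * p * s * q * f
      regroup = solve 5 (λ p s b f q → p :* s :* (b :* (f :* q)) := b :* p :* s :* q :* f) refl
      term-< : ∀ k i → i < k → term k i ≈ 0#
      term-< k i i<k = trans (*-congʳ (trans (*-congʳ (trans (*-congʳ (binom-> i<k)) (zeroˡ _))) (zeroˡ _)))
                             (zeroˡ _)

theorem3 : {c ℓ : Level} (R : CommutativeRing c ℓ) →
    let open CommutativeRing R in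
    let open Ring R in
    CharZero → NoZeroDivisors →
    (m : ℕ) → .{{NonZero m}} → (r : ℕ) → (l : Carrier) →
    (S : ℕ → ℕ → Carrier) → IsDegStirling1 l S →
    (V : ℕ → ℕ → Carrier) → IsDegWhitney1 m r (ι m * l) V →
    (n k : ℕ) → k ≤ n →
    V n k ≈ sumFromTo k n (λ i →
      binom i k * pow (ι m) (n ∸ i) * S n i * fallingλ (- ι r) (ι m * l) (i ∸ k))
theorem3 R charZero noZeroDivisors m r l S stirling V whitney n k k≤n =
  coefficients-unique (λ j → fallingλ-Polynomial (ι m) (ι r) μ j) (pow-nonZero (ι-nonZero m))
    n (λ x → trans (sym (whitney n x)) (expansion n x)) k k≤n
  where
  open Theory R
  open Domain charZero noZeroDivisors
  open Whitney m r l S stirling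
  open CommutativeRing R using (sym; trans)
  open Ring R using (ι)
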